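{- Let $G$ be a graph, let $L,d$ be positive integers, and let $\ell_G^{(1)},\ell_G^{(2)}\colon V(G)\to[L]\cup\{\infty\}$ be two partial layer assignments of $G$ with $L$ layers and out-degree $d$. Define $\ell_G(v)=\min\{\ell_G^{(1)}(v),\ell_G^{(2)}(v)\}$ for all $v\in V(G)$. Then $\ell_G$ is also a partial layer assignment of $G$ with $L$ layers and out-degree $d$.
   Context: $[L]=\{1,\dots,L\}$, and $\infty$ is larger than every integer. A partial layer assignment of $G$ with $L$ layers and out-degree $d$ is a function $\ell\colon V(G)\to[L]\cup\{\infty\}$ such that for every $v$ with $\ell(v)\ne\infty$, $|\{u\in N_G(v):\ell(u)\ge\ell(v)\}|\le d$, where $N_G(v)$ is the neighborhood of $v$. -}

module Defs where

open import Data.Nat using (ℕ; zero; suc; _≤_; _≤?_; _⊓_)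
open import Data.Fin using (Fin)
open import Data.Bool using (Bool; true; false; T)
open import Data.List using (List; filter; length; allFin)
open import Data.Product using (_×_; _,_; proj₁; proj₂)
open import Relation.Nullary using (¬_; Dec; yes; no)
open import Relation.Binary.PropositionalEquality using (_≡_)

record Graph (n : ℕ) : Set where
  field
    adj   : Fin n → Fin n → Bool
    sym   : ∀ u v → adj u v ≡ adj v u
    irrefl : ∀ v → adj v v ≡ false
open Graph public

-- [L] ∪ {∞}: finite layers are naturals (range checked separately), ∞ is above all.
data Layer : Set where
  fin : ℕ → Layer
  ∞   : Layer

data _≤ᴸ_ : Layer → Layer → Set where
  fin≤fin : ∀ {a b} → a ≤ b → fin a ≤ᴸ fin b
  x≤∞     : ∀ {x} → x ≤ᴸ ∞

_≤ᴸ?_ : (x y : Layer) → Dec (x ≤ᴸ y)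
x ≤ᴸ? ∞ = yes x≤∞
∞ ≤ᴸ? fin b = no (λ ())
fin a ≤ᴸ? fin b with a ≤? b
... | yes p = yes (fin≤fin p)
... | no ¬p = no (λ { (fin≤fin q) → ¬p q })

minᴸ : Layer → Layer → Layer
minᴸ ∞ y = y
minᴸ x ∞ = x
minᴸ (fin a) (fin b) = fin (a ⊓ b)

data InRange (L : ℕ) : Layer → Set where
  inFin : ∀ {a} → 1 ≤ a → a ≤ L → InRange L (fin a)
  inInf : InRange L ∞

outNbrs : ∀ {n} → Graph n → (Fin n → Layer) → Fin n → List (Fin n)
outNbrs G ℓ v = filter (λ u → dec u) (allFin _)
  where
  dec : ∀ u → Dec (T (adj G v u) × (ℓ v ≤ᴸ ℓ u))
  dec u with adj G v u | ℓ v ≤ᴸ? ℓ u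
  ... | true  | yes p = yes (_ , p)
  ... | true  | no ¬p = no (λ z → ¬p (proj₂ z))
  ... | false | _     = no (λ z → proj₁ z)

record IsPartialLayerAssignment {n : ℕ} (G : Graph n) (L d : ℕ)
                                (ℓ : Fin n → Layer) : Set where
  field
    range  : ∀ v → InRange L (ℓ v)
    outdeg : ∀ v → ¬ (ℓ v ≡ ∞) → length (outNbrs G ℓ v) ≤ d

{-# OPTIONS --safe #-}
module Submission where

open import Defs
open import Data.Nat using (ℕ; _≤_)
open import Data.Nat.Properties using (≤-refl; ≤-trans; m⊓n≤m; m⊓n≤n; ⊓-glb; ⊓-sel)
open import Data.Fin using (Fin)
open import Data.List using (length; allFin)
open import Data.List.Relation.Binary.Sublist.Propositional using (_⊆_; ⊆-refl)
open import Data.List.Relation.Binary.Sublist.Propositional.Properties using (filter⁺; length-mono-≤)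
open import Data.Sum using (_⊎_; inj₁; inj₂; [_,_]′)
open import Data.Product using (_,_)
open import Relation.Nullary using (¬_)
open import Relation.Binary.PropositionalEquality as ≡ using (_≡_; refl; cong; trans)

open IsPartialLayerAssignment

≤ᴸ-refl : ∀ {x} → x ≤ᴸ x
≤ᴸ-refl {fin a} = fin≤fin ≤-refl
≤ᴸ-refl {∞}     = x≤∞

≤ᴸ-reflexive : ∀ {x y} → x ≡ y → x ≤ᴸ y
≤ᴸ-reflexive refl = ≤ᴸ-refl

≤ᴸ-trans : ∀ {x y z} → x ≤ᴸ y → y ≤ᴸ z → x ≤ᴸ z
≤ᴸ-trans (fin≤fin p) (fin≤fin q) = fin≤fin (≤-trans p q)
≤ᴸ-trans _           x≤∞         = x≤∞

minᴸ-≤ˡ : ∀ x y → minᴸ x y ≤ᴸ x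
minᴸ-≤ˡ ∞       y       = x≤∞
minᴸ-≤ˡ (fin a) ∞       = ≤ᴸ-refl
minᴸ-≤ˡ (fin a) (fin b) = fin≤fin (m⊓n≤m a b)

minᴸ-≤ʳ : ∀ x y → minᴸ x y ≤ᴸ y
minᴸ-≤ʳ ∞       ∞       = x≤∞
minᴸ-≤ʳ ∞       (fin b) = ≤ᴸ-refl
minᴸ-≤ʳ (fin a) ∞       = x≤∞
minᴸ-≤ʳ (fin a) (fin b) = fin≤fin (m⊓n≤n a b)

minᴸ-sel : ∀ x y → minᴸ x y ≡ x ⊎ minᴸ x y ≡ y
minᴸ-sel ∞       y       = inj₂ refl
minᴸ-sel (fin a) ∞       = inj₁ refl
minᴸ-sel (fin a) (fin b) with ⊓-sel a b
... | inj₁ a⊓b≡a = inj₁ (cong fin a⊓b≡a)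
... | inj₂ a⊓b≡b = inj₂ (cong fin a⊓b≡b)

minᴸ-InRange : ∀ {L} x y → InRange L x → InRange L y → InRange L (minᴸ x y)
minᴸ-InRange ∞       y       _               y∈ = y∈
minᴸ-InRange (fin a) ∞       x∈              _  = x∈
minᴸ-InRange (fin a) (fin b) (inFin 1≤a a≤L) (inFin 1≤b _) =
  inFin (⊓-glb 1≤a 1≤b) (≤-trans (m⊓n≤m a b) a≤L)

-- Lowering the layers of all vertices but not that of v can only shrink the
-- out-neighbourhood of v: ℓ v ≤ ℓ' v ≤ ℓ' u ≤ ℓ u.
outNbrs-antitone : ∀ {n} (G : Graph n) {ℓ ℓ' : Fin n → Layer} v →
  ℓ v ≤ᴸ ℓ' v → (∀ u → ℓ' u ≤ᴸ ℓ u) → outNbrs G ℓ' v ⊆ outNbrs G ℓ v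
outNbrs-antitone {n} G v ℓv≤ℓ'v ℓ'≤ℓ = filter⁺ _ _ {as = allFin n} {bs = allFin n}
  (λ { refl (uv , ℓ'v≤ℓ'u) → uv , ≤ᴸ-trans ℓv≤ℓ'v (≤ᴸ-trans ℓ'v≤ℓ'u (ℓ'≤ℓ _)) })
  ⊆-refl

outdeg-of-lower : ∀ {n} {G : Graph n} {L d} {ℓ ℓ' : Fin n → Layer} →
  IsPartialLayerAssignment G L d ℓ → (∀ u → ℓ' u ≤ᴸ ℓ u) →
  ∀ v → ℓ' v ≡ ℓ v → ¬ ℓ' v ≡ ∞ → length (outNbrs G ℓ' v) ≤ d
outdeg-of-lower {G = G} isPLA ℓ'≤ℓ v ℓ'v≡ℓv ℓ'v≢∞ =
  ≤-trans (length-mono-≤ (outNbrs-antitone G v (≤ᴸ-reflexive (≡.sym ℓ'v≡ℓv)) ℓ'≤ℓ))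
          (outdeg isPLA v (λ ℓv≡∞ → ℓ'v≢∞ (trans ℓ'v≡ℓv ℓv≡∞)))

mainTheorem3 : {n : ℕ} (G : Graph n) (L d : ℕ) → 1 ≤ L → 1 ≤ d →
    (ℓ₁ ℓ₂ : Fin n → Layer) →
    IsPartialLayerAssignment G L d ℓ₁ →
    IsPartialLayerAssignment G L d ℓ₂ →
    IsPartialLayerAssignment G L d (λ v → minᴸ (ℓ₁ v) (ℓ₂ v))
mainTheorem3 G L d _ _ ℓ₁ ℓ₂ isPLA₁ isPLA₂ = record
  { range  = λ v → minᴸ-InRange (ℓ₁ v) (ℓ₂ v) (range isPLA₁ v) (range isPLA₂ v)
  ; outdeg = λ v → [ outdeg-of-lower isPLA₁ (λ u → minᴸ-≤ˡ (ℓ₁ u) (ℓ₂ u)) v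
                   , outdeg-of-lower isPLA₂ (λ u → minᴸ-≤ʳ (ℓ₁ u) (ℓ₂ u)) v
                   ]′ (minᴸ-sel (ℓ₁ v) (ℓ₂ v))
  }
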